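{- Let $\mathcal{C}$ be a nice clustering for a facility location instance $(F,D)$ and let $\alpha_j=2^{\ell(j)}$ for every client $j\in D$. Let $i\in F$ and $j,j'\in D$ satisfy $\alpha_j\ge d_{ij}$ and $\alpha_{j'}\ge d_{ij'}$. Then $\alpha_j/2^4\le d_{ij}+2\alpha_{j'}$.
   Context: Facility location: finite facility set $F$, finite client set $D$, in a common metric space; $d$ denotes the metric (so $d_{ij}>0$ is the distance between facility $i$ and client $j$, and the triangle inequality holds among all facilities and clients), $f_i\ge0$ the opening cost of facility $i$. Clusters: a cluster is a pair $C=(i,A)$ with $i\in F$, $A\subseteq D$, designated critical or satellite; satellite clusters have exactly one client. $cost(C)=\sum_{j\in A}d_{ij}$ if satellite, $f_i+\sum_{j\in A}d_{ij}$ if critical; $cost_{avg}(C)=cost(C)/|A|$. A clustering is a collection $\mathcal{C}$ of clusters in which every client of $D$ lies in exactly one cluster and, for each facility $i$ with $\mathcal{C}(i)$ (clusters of $\mathcal{C}$ with facility $i$) nonempty, exactly one cluster of $\mathcal{C}(i)$ is critical. Each $C\in\mathcal{C}$ has a level $\ell(C)\in\mathbb{Z}$; $\ell(j)=\ell(C)$ for clients $j$ of $C$. $\kappa^*_{ij}$ is the unique integer with $2^{\kappa^*_{ij}-4}\le d_{ij}<2^{\kappa^*_{ij}-3}$. A cluster $C=(i,A)$ (not necessarily in $\mathcal{C}$) is blocking at level $k$ w.r.t. $\mathcal{C}$ if (a) $cost_{avg}(C)<2^{k-3}$; (b) $\ell(j)>k\ge\kappa^*_{ij}$ for all $j\in A$;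 (c) if $C$ is satellite, some critical $C^*\in\mathcal{C}(i)$ has $\ell(C^*)\le k$; if $C$ is critical, $k\le\ell(C')$ for all $C'\in\mathcal{C}(i)$. $\mathcal{C}$ is nice if (I1) $cost_{avg}(C)<2^{\ell(C)}$ for all $C\in\mathcal{C}$; (I2) for each $i$ with $\mathcal{C}(i)\ne\emptyset$ the critical cluster $C^*\in\mathcal{C}(i)$ has $\ell(C^*)\le\ell(C)$ for all $C\in\mathcal{C}(i)$; (I3) $\ell(j)\ge\kappa^*_{ij}$ for every $C=(i,A)\in\mathcal{C}$, $j\in A$; (I4) no cluster is blocking at any level w.r.t. $\mathcal{C}$. -}

module Defs where

open import Level using (0ℓ)
open import Data.Nat as ℕ using (ℕ; zero; suc)
open import Data.Integer as ℤ using (ℤ; +_; -[1+_])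
open import Data.Fin using (Fin; zero; suc)
open import Data.Fin.Subset using (Subset; _∈_; ∣_∣)
open import Data.Vec using (lookup)
open import Data.Bool using (Bool; true; false; if_then_else_)
open import Data.Product using (Σ; ∃; ∃₂; _×_; _,_; proj₁)
open import Data.Sum using (_⊎_; inj₁; inj₂)
open import Relation.Nullary using (¬_)
open import Relation.Binary.PropositionalEquality using (_≡_)
import Algebra.Structures as AS
import Relation.Binary.Structures as RS

embedℕ : {R : Set} → R → R → (R → R → R) → ℕ → R
embedℕ z o p zero    = z
embedℕ z o p (suc n) = p o (embedℕ z o p n)

-- Distances take values in an arbitrary Archimedean ordered field
-- (the real numbers being the intended instance; ℝ is not available).

record OrderedField : Set₁ where
  infixl 7 _*_
  infixl 6 _+_
  infix  4 _<_
  field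
    R   : Set
    _+_ _*_ : R → R → R
    -_  : R → R
    0# 1# : R
    isCommutativeRing : AS.IsCommutativeRing {A = R} _≡_ _+_ _*_ -_ 0# 1#
    -- multiplicative inverse (value at 0 irrelevant / arbitrary)
    _⁻¹ : R → R
    ⁻¹-inverse : ∀ x → ¬ (x ≡ 0#) → x * (x ⁻¹) ≡ 1#
    0≢1 : ¬ (0# ≡ 1#)
    _<_ : R → R → Set
    isStrictTotalOrder : RS.IsStrictTotalOrder {A = R} _≡_ _<_
    +-monoʳ-< : ∀ z {x y} → x < y → z + x < z + y
    *-pos : ∀ {x y} → 0# < x → 0# < y → 0# < x * y
    archimedean : ∀ x → ∃ λ (n : ℕ) → x < embedℕ 0# 1# _+_ n

  infix 4 _≤_
  _≤_ : R → R → Set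
  x ≤ y = x < y ⊎ x ≡ y

  fromℕ : ℕ → R
  fromℕ = embedℕ 0# 1# _+_

  two : R
  two = 1# + 1#

  infixr 8 _^_
  _^_ : R → ℕ → R
  x ^ zero  = 1#
  x ^ suc n = x * (x ^ n)

  pow2 : ℤ → R
  pow2 (+ n)      = two ^ n
  pow2 -[1+ n ]   = (two ^ suc n) ⁻¹

-- A facility location instance: facilities Fin nF, clients Fin nD,
-- lying in a common (pseudo)metric space: δ is a pseudometric on the
-- disjoint union of facilities and clients, and d i j = δ (facility i) (client j).

module FacilityLocation (K : OrderedField) where
  open OrderedField K

  Point : ℕ → ℕ → Set
  Point nF nD = Fin nF ⊎ Fin nD

  record Instance (nF nD : ℕ) : Set where
    field
      δ       : Point nF nD → Point nF nD → R
      δ-refl  : ∀ x → δ x x ≡ 0#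
      δ-sym   : ∀ x y → δ x y ≡ δ y x
      δ-tri   : ∀ x y z → δ x z ≤ δ x y + δ y z
      f       : Fin nF → R
      f-nonneg : ∀ i → 0# ≤ f i
      d-pos   : ∀ i j → 0# < δ (inj₁ i) (inj₂ j)

    d : Fin nF → Fin nD → R
    d i j = δ (inj₁ i) (inj₂ j)

    IsKappa : Fin nF → Fin nD → ℤ → Set
    IsKappa i j k = (pow2 (k ℤ.- + 4) ≤ d i j) × (d i j < pow2 (k ℤ.- + 3))

    sumD : (Fin nD → R) → R
    sumD = go
      where
      go : ∀ {n} → (Fin n → R) → R
      go {zero}  g = 0#
      go {suc n} g = g zero + go (λ x → g (suc x))

  data Kind : Set where
    critical satellite : Kind

  module _ {nF nD : ℕ} (I : Instance nF nD) where
    open Instance I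

    connCost : Fin nF → Subset nD → R
    connCost i A = sumD (λ j → if lookup A j then d i j else 0#)

    cost : Kind → Fin nF → Subset nD → R
    cost satellite i A = connCost i A
    cost critical  i A = f i + connCost i A

    -- cost_avg(C) < t, i.e. cost(C)/|A| < t, written as cost(C) < |A|·t
    AvgCostLt : Kind → Fin nF → Subset nD → R → Set
    AvgCostLt κ i A t = cost κ i A < fromℕ ∣ A ∣ * t

    record Cluster : Set where
      field
        fac     : Fin nF
        members : Subset nD
        kind    : Kind
        sat-one : kind ≡ satellite → ∣ members ∣ ≡ 1

    record Clustering : Set where
      field
        m     : ℕ
        cl    : Fin m → Cluster
        level : Fin m → ℤ
        partition : ∀ j → ∃ λ c → j ∈ Cluster.members (cl c) ×
                      (∀ c' → j ∈ Cluster.members (cl c') → c ≡ c')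
        one-critical : ∀ i → (∃ λ c → Cluster.fac (cl c) ≡ i) →
                       ∃ λ c → (Cluster.fac (cl c) ≡ i × Cluster.kind (cl c) ≡ critical) ×
                         (∀ c' → Cluster.fac (cl c') ≡ i → Cluster.kind (cl c') ≡ critical → c ≡ c')

      home : Fin nD → Fin m
      home j = proj₁ (partition j)

      ℓ : Fin nD → ℤ
      ℓ j = level (home j)

    module _ (𝒞 : Clustering) where
      open Clustering 𝒞

      Blocking : Cluster → ℤ → Set
      Blocking C k =
          AvgCostLt (Cluster.kind C) (Cluster.fac C) (Cluster.members C) (pow2 (k ℤ.- + 3))
        × (∀ j → j ∈ Cluster.members C →
             (k ℤ.< ℓ j) × (∀ κ → IsKappa (Cluster.fac C) j κ → κ ℤ.≤ k))
        × KindCond (Cluster.kind C) (Cluster.fac C)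
        where
        KindCond : Kind → Fin nF → Set
        KindCond satellite i = ∃ λ c → Cluster.fac (cl c) ≡ i ×
                                 Cluster.kind (cl c) ≡ critical × level c ℤ.≤ k
        KindCond critical  i = ∀ c → Cluster.fac (cl c) ≡ i → k ℤ.≤ level c

      record Nice : Set where
        field
          I1 : ∀ c → AvgCostLt (Cluster.kind (cl c)) (Cluster.fac (cl c))
                       (Cluster.members (cl c)) (pow2 (level c))
          I2 : ∀ c c' → Cluster.kind (cl c) ≡ critical →
                 Cluster.fac (cl c) ≡ Cluster.fac (cl c') → level c ℤ.≤ level c'
          I3 : ∀ c j → j ∈ Cluster.members (cl c) →
                 ∀ κ → IsKappa (Cluster.fac (cl c)) j κ → κ ℤ.≤ level c
          I4 : ∀ C k → ¬ Blocking C k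

      α : Fin nD → R
      α j = pow2 (ℓ j)

{-# OPTIONS --safe #-}
-- Suppose α_j / 2⁴ > d_ij + 2α_j′ and let i′ be the facility of the cluster of j′. Invariant I3
-- forces d_i′j′ < α_j′, so by the triangle inequality d_i′j < α_j / 2⁴. The satellite cluster
-- (i′, {j}) at level ℓ(j) - 1 is then blocking: its cost is below 2^(ℓ(j)-4), its client lies at
-- the higher level ℓ(j), and the critical cluster of i′ has level at most ℓ(j′) (I2), which is
-- below ℓ(j) - 1 since 2α_j′ < α_j / 2⁴. This contradicts I4.
module Submission where

open import Defs
open import Data.Nat as ℕ using (ℕ; zero; suc)
open import Data.Integer as ℤ using (ℤ; +_; -[1+_])
import Data.Integer.Properties as ℤ
import Data.Integer.Tactic.RingSolver as ℤ-Solver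
open import Data.Fin using (Fin; zero; suc)
open import Data.Fin.Subset using (⁅_⁆; ⊥; _∈_)
open import Data.Fin.Subset.Properties using (∣⁅x⁆∣≡1; x∈⁅y⁆⇒x≡y)
open import Data.Vec using (lookup)
open import Data.Bool using (if_then_else_)
open import Data.Product using (∃; _×_; _,_; proj₁; proj₂)
open import Data.Sum using (inj₁; inj₂)
open import Data.Empty using (⊥-elim)
open import Relation.Nullary using (¬_; yes; no)
open import Relation.Binary.PropositionalEquality
open import Relation.Binary.Definitions using (tri<; tri≈; tri>)
import Relation.Binary.Structures as RS
open import Algebra.Bundles using (CommutativeRing)

i+[1+n]≡suc[i+n] : ∀ i n → i ℤ.+ + suc n ≡ ℤ.suc (i ℤ.+ + n)
i+[1+n]≡suc[i+n] i n = trans (ℤ.+-comm i (+ suc n)) (trans (ℤ.suc-+ n i) (cong ℤ.suc (ℤ.+-comm (+ n) i)))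

i+[1+n]≡suc[i]+n : ∀ i n → i ℤ.+ + suc n ≡ ℤ.suc i ℤ.+ + n
i+[1+n]≡suc[i]+n i n = trans (i+[1+n]≡suc[i+n] i n) (sym (ℤ.+-assoc (+ 1) i (+ n)))

i-n+n≡i : ∀ i n → (i ℤ.- + n) ℤ.+ + n ≡ i
i-n+n≡i i n = trans (ℤ.+-assoc i (ℤ.- + n) (+ n))
  (trans (cong (λ u → i ℤ.+ u) (ℤ.+-inverseˡ (+ n))) (ℤ.+-identityʳ i))

i+∣j-i∣≡j : ∀ {i j} → i ℤ.≤ j → i ℤ.+ + ℤ.∣ j ℤ.- i ∣ ≡ j
i+∣j-i∣≡j {i} {j} i≤j = trans (cong (λ u → i ℤ.+ u) (ℤ.0≤i⇒+∣i∣≡i (ℤ.i≤j⇒0≤j-i i≤j))) (i+[j-i]≡j i j)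
  where
  i+[j-i]≡j : ∀ i j → i ℤ.+ (j ℤ.- i) ≡ j
  i+[j-i]≡j = ℤ-Solver.solve-∀

module OrderedFieldProperties (K : OrderedField) where
  open OrderedField K
  open RS.IsStrictTotalOrder isStrictTotalOrder using (compare; irrefl; asym; <-respʳ-≈; <-respˡ-≈; <-resp-≈)
  open RS.IsStrictTotalOrder isStrictTotalOrder public using (_<?_) renaming (trans to <-trans)
  import Relation.Binary.Construct.StrictToNonStrict _≡_ _<_ as NonStrict
  open ≡-Reasoning

  commutativeRing : CommutativeRing _ _
  commutativeRing = record { isCommutativeRing = isCommutativeRing }

  open CommutativeRing commutativeRing using
    ( +-comm; +-assoc; +-identityˡ; +-identityʳ; -‿inverseˡ; -‿inverseʳ
    ; *-comm; *-assoc; *-identityˡ; *-identityʳ; distribʳ; zeroʳ)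
  open import Algebra.Properties.Ring (CommutativeRing.ring commutativeRing)
    using (-‿involutive; -1*x≈-x; -‿distribʳ-*)

  <-irrefl : ∀ {x} → ¬ (x < x)
  <-irrefl = irrefl refl

  <-≤-trans : ∀ {x y z} → x < y → y ≤ z → x < z
  <-≤-trans = NonStrict.<-≤-trans <-trans <-respʳ-≈

  ≤-<-trans : ∀ {x y z} → x ≤ y → y < z → x < z
  ≤-<-trans = NonStrict.≤-<-trans sym <-trans <-respˡ-≈

  ≤-trans : ∀ {x y z} → x ≤ y → y ≤ z → x ≤ z
  ≤-trans = NonStrict.trans isEquivalence <-resp-≈ <-trans

  ≮⇒≥ : ∀ {x y} → ¬ (x < y) → y ≤ x
  ≮⇒≥ {x} {y} x≮y with compare x y
  ... | tri< x<y _ _ = ⊥-elim (x≮y x<y)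
  ... | tri≈ _ x≡y _ = inj₂ (sym x≡y)
  ... | tri> _ _ y<x = inj₁ y<x

  +-monoˡ-< : ∀ z {x y} → x < y → x + z < y + z
  +-monoˡ-< z {x} {y} x<y = subst₂ _<_ (+-comm z x) (+-comm z y) (+-monoʳ-< z x<y)

  +-monoˡ-≤ : ∀ z {x y} → x ≤ y → x + z ≤ y + z
  +-monoˡ-≤ z (inj₁ x<y) = inj₁ (+-monoˡ-< z x<y)
  +-monoˡ-≤ z (inj₂ refl) = inj₂ refl

  +-mono-≤-< : ∀ {a b c d} → a ≤ b → c < d → a + c < b + d
  +-mono-≤-< {b = b} a≤b c<d = ≤-<-trans (+-monoˡ-≤ _ a≤b) (+-monoʳ-< b c<d)

  +-mono-<-≤ : ∀ {a b c d} → a < b → c ≤ d → a + c < b + d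
  +-mono-<-≤ {a} {b} {c} {d} a<b c≤d = subst₂ _<_ (+-comm c a) (+-comm d b) (+-mono-≤-< c≤d a<b)

  +-mono-≤ : ∀ {a b c d} → a ≤ b → c ≤ d → a + c ≤ b + d
  +-mono-≤ a≤b (inj₁ c<d) = inj₁ (+-mono-≤-< a≤b c<d)
  +-mono-≤ a≤b (inj₂ refl) = +-monoˡ-≤ _ a≤b

  x<x+y : ∀ {x y} → 0# < y → x < x + y
  x<x+y {x} 0<y = subst (_< x + _) (+-identityʳ x) (+-monoʳ-< x 0<y)

  x<y+x : ∀ {x y} → 0# < y → x < y + x
  x<y+x {x} {y} 0<y = subst (x <_) (+-comm x y) (x<x+y 0<y)

  neg-pos : ∀ {x} → x < 0# → 0# < - x
  neg-pos {x} x<0 = subst₂ _<_ (-‿inverseˡ x) (+-identityʳ (- x)) (+-monoʳ-< (- x) x<0)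

  0<1 : 0# < 1#
  0<1 with compare 0# 1#
  ... | tri< 0<1 _ _ = 0<1
  ... | tri≈ _ 0≡1 _ = ⊥-elim (0≢1 0≡1)
  ... | tri> _ _ 1<0 = ⊥-elim (asym 1<0 (subst (0# <_) [-1]²≡1 (*-pos 0<-1 0<-1)))
    where
    0<-1 : 0# < - 1#
    0<-1 = neg-pos 1<0
    [-1]²≡1 : - 1# * - 1# ≡ 1#
    [-1]²≡1 = trans (-1*x≈-x (- 1#)) (-‿involutive 1#)

  pos⇒≢0 : ∀ {x} → 0# < x → ¬ (x ≡ 0#)
  pos⇒≢0 0<x refl = <-irrefl 0<x

  ⁻¹-pos : ∀ {x} → 0# < x → 0# < x ⁻¹
  ⁻¹-pos {x} 0<x with compare 0# (x ⁻¹)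
  ... | tri< 0<x⁻¹ _ _ = 0<x⁻¹
  ... | tri≈ _ 0≡x⁻¹ _ = ⊥-elim (0≢1 (begin
    0#          ≡⟨ sym (zeroʳ x) ⟩
    x * 0#      ≡⟨ cong (x *_) 0≡x⁻¹ ⟩
    x * x ⁻¹    ≡⟨ ⁻¹-inverse x (pos⇒≢0 0<x) ⟩
    1#          ∎))
  ... | tri> _ _ x⁻¹<0 = ⊥-elim (asym 0<1 1<0)
    where
    x*-x⁻¹≡-1 : x * - (x ⁻¹) ≡ - 1#
    x*-x⁻¹≡-1 = trans (sym (-‿distribʳ-* x (x ⁻¹))) (cong -_ (⁻¹-inverse x (pos⇒≢0 0<x)))
    1<0 : 1# < 0#
    1<0 = subst₂ _<_ (+-identityʳ 1#) (-‿inverseʳ 1#)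
            (+-monoʳ-< 1# (subst (0# <_) x*-x⁻¹≡-1 (*-pos 0<x (neg-pos x⁻¹<0))))

  ⁻¹-unique : ∀ {x y} → ¬ (x ≡ 0#) → x * y ≡ 1# → y ≡ x ⁻¹
  ⁻¹-unique {x} {y} x≢0 xy≡1 = begin
    y                ≡⟨ sym (*-identityʳ y) ⟩
    y * 1#           ≡⟨ cong (y *_) (sym (⁻¹-inverse x x≢0)) ⟩
    y * (x * x ⁻¹)   ≡⟨ sym (*-assoc y x (x ⁻¹)) ⟩
    (y * x) * x ⁻¹   ≡⟨ cong (_* x ⁻¹) (trans (*-comm y x) xy≡1) ⟩
    1# * x ⁻¹        ≡⟨ *-identityˡ (x ⁻¹) ⟩
    x ⁻¹             ∎

  *-⁻¹-cancel : ∀ {x} → ¬ (x ≡ 0#) → ∀ y → (x * y) * x ⁻¹ ≡ y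
  *-⁻¹-cancel {x} x≢0 y = begin
    (x * y) * x ⁻¹   ≡⟨ cong (_* x ⁻¹) (*-comm x y) ⟩
    (y * x) * x ⁻¹   ≡⟨ *-assoc y x (x ⁻¹) ⟩
    y * (x * x ⁻¹)   ≡⟨ cong (y *_) (⁻¹-inverse x x≢0) ⟩
    y * 1#           ≡⟨ *-identityʳ y ⟩
    y                ∎

  two*x≡x+x : ∀ x → two * x ≡ x + x
  two*x≡x+x x = trans (distribʳ x 1# 1#) (cong₂ _+_ (*-identityˡ x) (*-identityˡ x))

  0<two : 0# < two
  0<two = <-trans 0<1 (x<x+y 0<1)

  two^-pos : ∀ n → 0# < two ^ n
  two^-pos zero = 0<1
  two^-pos (suc n) = *-pos 0<two (two^-pos n)

  pow2-pos : ∀ k → 0# < pow2 k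
  pow2-pos (+ n) = two^-pos n
  pow2-pos -[1+ n ] = ⁻¹-pos (two^-pos (suc n))

  pow2-suc : ∀ k → pow2 (ℤ.suc k) ≡ two * pow2 k
  pow2-suc (+ n) = refl
  pow2-suc -[1+ zero ] = sym (begin
    two * (two * 1#) ⁻¹          ≡⟨ cong (_* (two * 1#) ⁻¹) (sym (*-identityʳ two)) ⟩
    (two * 1#) * (two * 1#) ⁻¹   ≡⟨ ⁻¹-inverse (two * 1#) (pos⇒≢0 (two^-pos 1)) ⟩
    1#                           ∎)
  pow2-suc -[1+ suc n ] = sym (⁻¹-unique (pos⇒≢0 (two^-pos (suc n))) (begin
    two ^ suc n * (two * (two * two ^ suc n) ⁻¹)   ≡⟨ sym (*-assoc _ two _) ⟩
    (two ^ suc n * two) * (two * two ^ suc n) ⁻¹   ≡⟨ cong (_* (two * two ^ suc n) ⁻¹) (*-comm _ two) ⟩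
    (two * two ^ suc n) * (two * two ^ suc n) ⁻¹   ≡⟨ ⁻¹-inverse _ (pos⇒≢0 (two^-pos (suc (suc n)))) ⟩
    1#                                             ∎))

  pow2-+ : ∀ k n → pow2 (k ℤ.+ + n) ≡ two ^ n * pow2 k
  pow2-+ k zero = trans (cong pow2 (ℤ.+-identityʳ k)) (sym (*-identityˡ (pow2 k)))
  pow2-+ k (suc n) = begin
    pow2 (k ℤ.+ + suc n)            ≡⟨ cong pow2 (i+[1+n]≡suc[i+n] k n) ⟩
    pow2 (ℤ.suc (k ℤ.+ + n))        ≡⟨ pow2-suc (k ℤ.+ + n) ⟩
    two * pow2 (k ℤ.+ + n)          ≡⟨ cong (two *_) (pow2-+ k n) ⟩
    two * (two ^ n * pow2 k)        ≡⟨ sym (*-assoc two (two ^ n) (pow2 k)) ⟩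
    two ^ suc n * pow2 k            ∎

  pow2-<-suc : ∀ k → pow2 k < pow2 (ℤ.suc k)
  pow2-<-suc k = subst (pow2 k <_) (sym (trans (pow2-suc k) (two*x≡x+x (pow2 k)))) (x<x+y (pow2-pos k))

  pow2-≤-+ : ∀ k n → pow2 k ≤ pow2 (k ℤ.+ + n)
  pow2-≤-+ k zero = inj₂ (cong pow2 (sym (ℤ.+-identityʳ k)))
  pow2-≤-+ k (suc n) = inj₁ (≤-<-trans (pow2-≤-+ k n)
    (subst (λ u → pow2 (k ℤ.+ + n) < pow2 u) (sym (i+[1+n]≡suc[i+n] k n)) (pow2-<-suc (k ℤ.+ + n))))

  pow2-mono-≤ : ∀ {k k′} → k ℤ.≤ k′ → pow2 k ≤ pow2 k′
  pow2-mono-≤ {k} k≤k′ = subst (λ u → pow2 k ≤ pow2 u) (i+∣j-i∣≡j k≤k′) (pow2-≤-+ k _)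

  pow2-cancel-< : ∀ {k k′} → pow2 k < pow2 k′ → k ℤ.< k′
  pow2-cancel-< {k} {k′} 2^k<2^k′ with k ℤ.<? k′
  ... | yes k<k′ = k<k′
  ... | no k≮k′ = ⊥-elim (<-irrefl (<-≤-trans 2^k<2^k′ (pow2-mono-≤ (ℤ.≮⇒≥ k≮k′))))

  fromℕ≤two^ : ∀ n → fromℕ n ≤ two ^ n
  fromℕ≤two^ zero = inj₁ 0<1
  fromℕ≤two^ (suc n) = subst (1# + fromℕ n ≤_) (sym (two*x≡x+x (two ^ n)))
    (+-mono-≤ (pow2-mono-≤ {k′ = + n} (ℤ.+≤+ ℕ.z≤n)) (fromℕ≤two^ n))

  pow2-bracket-search : ∀ {x} N s → pow2 s ≤ x → x < pow2 (s ℤ.+ + N) →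
                        ∃ λ t → s ℤ.≤ t × pow2 t ≤ x × x < pow2 (ℤ.suc t)
  pow2-bracket-search zero s 2^s≤x x<2^s =
    ⊥-elim (<-irrefl (≤-<-trans 2^s≤x (subst (λ u → _ < pow2 u) (ℤ.+-identityʳ s) x<2^s)))
  pow2-bracket-search {x} (suc N) s 2^s≤x x<2^[s+N+1] with x <? pow2 (ℤ.suc s)
  ... | yes x<2^[1+s] = s , ℤ.≤-refl , 2^s≤x , x<2^[1+s]
  ... | no x≮2^[1+s]
    with pow2-bracket-search N (ℤ.suc s) (≮⇒≥ x≮2^[1+s])
           (subst (λ u → x < pow2 u) (i+[1+n]≡suc[i]+n s N) x<2^[s+N+1])
  ...   | t , 1+s≤t , bracket = t , ℤ.≤-trans (ℤ.i≤suc[i] s) 1+s≤t , bracket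

  pow2-bracket : ∀ {x s} → pow2 s ≤ x → ∃ λ t → s ℤ.≤ t × pow2 t ≤ x × x < pow2 (ℤ.suc t)
  pow2-bracket {x} {s} 2^s≤x with archimedean x
  ... | n , x<n = pow2-bracket-search _ s 2^s≤x (subst (λ u → x < pow2 u) (sym (i+∣j-i∣≡j s≤n)) x<2^n)
    where
    x<2^n : x < pow2 (+ n)
    x<2^n = <-≤-trans x<n (fromℕ≤two^ n)
    s≤n : s ℤ.≤ + n
    s≤n = ℤ.<⇒≤ (pow2-cancel-< (≤-<-trans 2^s≤x x<2^n))

  pow2-*-two^-⁻¹ : ∀ k n → pow2 k * (two ^ n) ⁻¹ ≡ pow2 (k ℤ.- + n)
  pow2-*-two^-⁻¹ k n = begin
    pow2 k * (two ^ n) ⁻¹                         ≡⟨ cong (λ u → pow2 u * (two ^ n) ⁻¹) (sym (i-n+n≡i k n)) ⟩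
    pow2 ((k ℤ.- + n) ℤ.+ + n) * (two ^ n) ⁻¹     ≡⟨ cong (_* (two ^ n) ⁻¹) (pow2-+ (k ℤ.- + n) n) ⟩
    (two ^ n * pow2 (k ℤ.- + n)) * (two ^ n) ⁻¹   ≡⟨ *-⁻¹-cancel (pos⇒≢0 (two^-pos n)) (pow2 (k ℤ.- + n)) ⟩
    pow2 (k ℤ.- + n)                              ∎

module FacilityLocationProperties (K : OrderedField) where
  open OrderedField K
  open OrderedFieldProperties K
  open FacilityLocation K
  open CommutativeRing commutativeRing using (+-identityˡ; +-identityʳ; +-assoc; +-comm; *-identityˡ)
  open ≡-Reasoning

  -- sumD does not use the fields of its instance, so it can be evaluated in one without facilities.
  private
    noFacilities : ∀ n → Instance 0 n
    noFacilities n = record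
      { δ = λ _ _ → 0# ; δ-refl = λ _ → refl ; δ-sym = λ _ _ → refl
      ; δ-tri = λ _ _ _ → inj₂ (sym (+-identityʳ 0#))
      ; f = λ () ; f-nonneg = λ () ; d-pos = λ () }

    sum-over : ∀ {n} → (Fin n → R) → R
    sum-over {n} = Instance.sumD (noFacilities n)

    sum-over-⊥ : ∀ n (g : Fin n → R) → sum-over (λ x → if lookup (⊥ {n}) x then g x else 0#) ≡ 0#
    sum-over-⊥ zero g = refl
    sum-over-⊥ (suc n) g = trans (cong (λ u → 0# + u) (sum-over-⊥ n (λ x → g (suc x)))) (+-identityʳ 0#)

    sum-over-⁅⁆ : ∀ n (g : Fin n → R) j → sum-over (λ x → if lookup ⁅ j ⁆ x then g x else 0#) ≡ g j
    sum-over-⁅⁆ (suc n) g zero =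
      trans (cong (λ u → g zero + u) (sum-over-⊥ n (λ x → g (suc x)))) (+-identityʳ (g zero))
    sum-over-⁅⁆ (suc n) g (suc j) =
      trans (cong (λ u → 0# + u) (sum-over-⁅⁆ n (λ x → g (suc x)) j)) (+-identityˡ (g (suc j)))

  connCost-⁅⁆ : ∀ {nF nD} (I : Instance nF nD) i j → connCost I i ⁅ j ⁆ ≡ Instance.d I i j
  connCost-⁅⁆ {nD = nD} I i j = sum-over-⁅⁆ nD (Instance.d I i) j

  module InstanceProperties {nF nD} (I : Instance nF nD) where
    open Instance I

    d-triangle : ∀ i i′ j j′ → d i′ j ≤ d i′ j′ + (d i j′ + d i j)
    d-triangle i i′ j j′ = ≤-trans (δ-tri (inj₁ i′) (inj₂ j′) (inj₂ j)) (+-mono-≤ (inj₂ refl) δj′j≤)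
      where
      δj′j≤ : δ (inj₂ j′) (inj₂ j) ≤ d i j′ + d i j
      δj′j≤ = subst (λ u → δ (inj₂ j′) (inj₂ j) ≤ u + d i j) (δ-sym (inj₂ j′) (inj₁ i))
                (δ-tri (inj₂ j′) (inj₁ i) (inj₂ j))

    IsKappa-intro : ∀ {i j t} → pow2 t ≤ d i j → d i j < pow2 (ℤ.suc t) → IsKappa i j (t ℤ.+ + 4)
    IsKappa-intro {i} {j} {t} 2^t≤d d<2^[1+t] =
      subst (λ u → pow2 u ≤ d i j) (sym (t+4-4≡t t)) 2^t≤d ,
      subst (λ u → d i j < pow2 u) (sym (t+4-3≡1+t t)) d<2^[1+t]
      where
      t+4-4≡t : ∀ t → t ℤ.+ + 4 ℤ.- + 4 ≡ t
      t+4-4≡t = ℤ-Solver.solve-∀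
      t+4-3≡1+t : ∀ t → t ℤ.+ + 4 ℤ.- + 3 ≡ + 1 ℤ.+ t
      t+4-3≡1+t = ℤ-Solver.solve-∀

    IsKappa-≤ : ∀ {i j κ k} → IsKappa i j κ → d i j < pow2 (k ℤ.- + 3) → κ ℤ.≤ k
    IsKappa-≤ {κ = κ} {k} (2^[κ-4]≤d , _) d<2^[k-3] = subst (κ ℤ.≤_) (ℤ.pred-suc k)
      (ℤ.i<j⇒i≤pred[j] (subst₂ ℤ._<_ (κ-4+4≡κ κ) (k-3+4≡1+k k)
        (ℤ.+-monoˡ-< (+ 4) (pow2-cancel-< {κ ℤ.- + 4} {k ℤ.- + 3} (≤-<-trans 2^[κ-4]≤d d<2^[k-3])))))
      where
      κ-4+4≡κ : ∀ κ → κ ℤ.- + 4 ℤ.+ + 4 ≡ κ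
      κ-4+4≡κ = ℤ-Solver.solve-∀
      k-3+4≡1+k : ∀ k → k ℤ.- + 3 ℤ.+ + 4 ≡ + 1 ℤ.+ k
      k-3+4≡1+k = ℤ-Solver.solve-∀

    module ClusteringProperties (𝒞 : Clustering I) where
      open Clustering 𝒞

      satelliteAt : Fin nF → Fin nD → Cluster I
      satelliteAt i j = record { fac = i ; members = ⁅ j ⁆ ; kind = satellite ; sat-one = λ _ → ∣⁅x⁆∣≡1 j }

      satellite-blocking : ∀ {i j k} c → Cluster.fac (cl c) ≡ i → Cluster.kind (cl c) ≡ critical →
                           level c ℤ.≤ k → k ℤ.< ℓ j → d i j < pow2 (k ℤ.- + 3) →
                           Blocking I 𝒞 (satelliteAt i j) k
      satellite-blocking {i} {j} {k} c c-fac c-critical c≤k k<ℓj d<2^[k-3] =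
        avgCost , singleton-members , (c , c-fac , c-critical , c≤k)
        where
        1*x≡x : ∀ x → fromℕ 1 * x ≡ x
        1*x≡x x = trans (cong (_* x) (+-identityʳ 1#)) (*-identityˡ x)

        avgCost : AvgCostLt I satellite i ⁅ j ⁆ (pow2 (k ℤ.- + 3))
        avgCost = subst₂ _<_ (sym (connCost-⁅⁆ I i j))
                    (sym (trans (cong (λ n → fromℕ n * _) (∣⁅x⁆∣≡1 j)) (1*x≡x _))) d<2^[k-3]

        singleton-members : ∀ x → x ∈ ⁅ j ⁆ → (k ℤ.< ℓ x) × (∀ κ → IsKappa i x κ → κ ℤ.≤ k)
        singleton-members x x∈⁅j⁆ with x∈⁅y⁆⇒x≡y j x∈⁅j⁆
        ... | refl = k<ℓj , λ κ isKappa → IsKappa-≤ isKappa d<2^[k-3]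

    module NiceClusteringProperties (𝒞 : Clustering I) (nice : Nice I 𝒞) where
      open Clustering 𝒞
      open Nice nice
      open ClusteringProperties 𝒞

      homeFacility : Fin nD → Fin nF
      homeFacility j = Cluster.fac (cl (home j))

      ∈-home : ∀ j → j ∈ Cluster.members (cl (home j))
      ∈-home j = proj₁ (proj₂ (partition j))

      d-homeFacility<α : ∀ j → d (homeFacility j) j < α I 𝒞 j
      d-homeFacility<α j with d (homeFacility j) j <? α I 𝒞 j
      ... | yes d<α = d<α
      ... | no d≮α with pow2-bracket (≮⇒≥ d≮α)
      ...   | t , ℓj≤t , 2^t≤d , d<2^[1+t] = ⊥-elim (ℤ.<⇒≱ (ℤ.≤-<-trans ℓj≤t t<t+4) κ≤ℓj)
        where
        κ≤ℓj : t ℤ.+ + 4 ℤ.≤ ℓ j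
        κ≤ℓj = I3 (home j) j (∈-home j) (t ℤ.+ + 4) (IsKappa-intro {t = t} 2^t≤d d<2^[1+t])
        t<t+4 : t ℤ.< t ℤ.+ + 4
        t<t+4 = subst (ℤ._< t ℤ.+ + 4) (ℤ.+-identityʳ t) (ℤ.+-monoʳ-< t (ℤ.+<+ (ℕ.s≤s ℕ.z≤n)))

      critical-below-home : ∀ j → ∃ λ c → Cluster.fac (cl c) ≡ homeFacility j ×
                              Cluster.kind (cl c) ≡ critical × level c ℤ.≤ ℓ j
      critical-below-home j with one-critical (homeFacility j) (home j , refl)
      ... | c , (c-fac , c-critical) , _ = c , c-fac , c-critical , I2 c (home j) c-critical c-fac

      d+2α≮2^[ℓ-4] : ∀ i j j′ → d i j′ ≤ α I 𝒞 j′ → ¬ (d i j + two * α I 𝒞 j′ < pow2 (ℓ j ℤ.- + 4))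
      d+2α≮2^[ℓ-4] i j j′ dij′≤αj′ gap with critical-below-home j′
      ... | c , c-fac , c-critical , c≤ℓj′ =
        I4 (satelliteAt i′ j) k (satellite-blocking c c-fac c-critical c≤k k<ℓj d<2^[k-3])
        where
        i′ = homeFacility j′
        αj′ = α I 𝒞 j′
        k = ℓ j ℤ.- + 1

        gap′ : d i j + two * αj′ < pow2 (k ℤ.- + 3)
        gap′ = subst (λ u → d i j + two * αj′ < pow2 u) (sym (a-1-3≡a-4 (ℓ j))) gap
          where
          a-1-3≡a-4 : ∀ a → a ℤ.- + 1 ℤ.- + 3 ≡ a ℤ.- + 4
          a-1-3≡a-4 = ℤ-Solver.solve-∀

        k<ℓj : k ℤ.< ℓ j
        k<ℓj = subst (k ℤ.<_) (ℤ.+-identityʳ (ℓ j)) (ℤ.+-monoʳ-< (ℓ j) ℤ.-<+)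

        triangle-bound : d i′ j′ + (d i j′ + d i j) < d i j + two * αj′
        triangle-bound = subst (d i′ j′ + (d i j′ + d i j) <_) rearrange
          (+-mono-<-≤ (d-homeFacility<α j′) (+-monoˡ-≤ (d i j) dij′≤αj′))
          where
          rearrange : αj′ + (αj′ + d i j) ≡ d i j + two * αj′
          rearrange = begin
            αj′ + (αj′ + d i j)   ≡⟨ sym (+-assoc αj′ αj′ (d i j)) ⟩
            (αj′ + αj′) + d i j   ≡⟨ +-comm (αj′ + αj′) (d i j) ⟩
            d i j + (αj′ + αj′)   ≡⟨ cong (λ u → d i j + u) (sym (two*x≡x+x αj′)) ⟩
            d i j + two * αj′     ∎

        d<2^[k-3] : d i′ j < pow2 (k ℤ.- + 3)
        d<2^[k-3] = ≤-<-trans (d-triangle i i′ j j′) (<-trans triangle-bound gap′)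

        ℓj′<k : ℓ j′ ℤ.< k
        ℓj′<k = pow2-cancel-< {ℓ j′} {k} (<-≤-trans (<-trans αj′<2αj′ (<-trans (x<y+x (d-pos i j)) gap′))
                                         (pow2-mono-≤ {k ℤ.- + 3} {k} (ℤ.i≤j⇒i-k≤j (+ 3) ℤ.≤-refl)))
          where
          αj′<2αj′ : αj′ < two * αj′
          αj′<2αj′ = subst (αj′ <_) (sym (two*x≡x+x αj′)) (x<x+y (pow2-pos (ℓ j′)))

        c≤k : level c ℤ.≤ k
        c≤k = ℤ.≤-trans c≤ℓj′ (ℤ.<⇒≤ ℓj′<k)

lemma5 : (K : OrderedField) → let open OrderedField K in let open FacilityLocation K in
    {nF nD : ℕ} (I : Instance nF nD) → let open Instance I in
    (𝒞 : Clustering I) → Nice I 𝒞 →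
    (i : Fin nF) (j j′ : Fin nD) →
    d i j ≤ α I 𝒞 j → d i j′ ≤ α I 𝒞 j′ →
    α I 𝒞 j * (two ^ 4) ⁻¹ ≤ d i j + two * α I 𝒞 j′
lemma5 K I 𝒞 nice i j j′ _ dij′≤αj′ =
  subst (_≤ d i j + two * α I 𝒞 j′) (sym (pow2-*-two^-⁻¹ (ℓ j) 4)) (≮⇒≥ (d+2α≮2^[ℓ-4] i j j′ dij′≤αj′))
  where
  open OrderedField K
  open OrderedFieldProperties K
  open FacilityLocation K
  open FacilityLocationProperties K
  open Instance I
  open InstanceProperties I
  open Clustering 𝒞
  open NiceClusteringProperties 𝒞 nice
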